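{- Define $(t'_n)_{n\ge0}$ by $t'_0 = 1$, $t'_1 = 0$, and $t'_{2n} = 1 - t'_n$, $t'_{2n+1} = t'_n$ for $n \geq 1$. Let $C = \{n \geq 0 : t'_n = 0\}$ and $D = \{ n \geq 0 : t'_n = 1\}$. Then for all $n \geq 1$, $$|\{(x,y)\in\mathbb{N}^2 : x,y\in C,\ x+y=n,\ x\le y\}| = |\{(x,y)\in\mathbb{N}^2 : x,y\in D,\ x+y=n,\ x\le y\}|.$$
   Context: $\mathbb{N}=\{0,1,2,\ldots\}$. For $n\ge 1$, $t'_n$ is the parity of the number of $0$'s in the binary representation of $n$ (without leading zeros). -}

module Defs where

open import Data.Nat using (ℕ; zero; suc; _+_; _∸_; _≤_; _≤?_; _≟_; _/_; _%_)
open import Data.List using (List; filter; length; upTo; cartesianProduct)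
open import Data.Product using (_×_; _,_; proj₁; proj₂)
open import Relation.Nullary.Decidable using (_×-dec_)

-- The fuel argument only ensures termination; fuel = n suffices
-- because n / 2 < n for n ≥ 2, so the fuel-0 clause is never reached
-- from t' below.
tp-aux : ℕ → ℕ → ℕ
tp-aux _ 0 = 1
tp-aux _ 1 = 0
tp-aux zero (suc (suc n)) = 0
tp-aux (suc f) (suc (suc n)) with (suc (suc n)) % 2
... | 0 = 1 ∸ tp-aux f ((suc (suc n)) / 2)
... | _ = tp-aux f ((suc (suc n)) / 2)

t' : ℕ → ℕ
t' n = tp-aux n n


pairs : ℕ → ℕ → List (ℕ × ℕ)
pairs b n = filter (λ p → (t' (proj₁ p) ≟ b) ×-dec ((t' (proj₂ p) ≟ b)
              ×-dec (((proj₁ p + proj₂ p) ≟ n) ×-dec (proj₁ p ≤? proj₂ p))))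
            (cartesianProduct (upTo (suc n)) (upTo (suc n)))

pairCount : ℕ → ℕ → ℕ
pairCount b n = length (pairs b n)

module Submission where

-- For x ≤ n ∸ x the indicators of "t'ₓ = t'ₙ₋ₓ = 0" and "t'ₓ = t'ₙ₋ₓ = 1" differ by
-- 1 − t'ₓ − t'ₙ₋ₓ, so with m = ⌊n/2⌋ the two counts differ by
-- (m + 1) − ∑_{x ≤ m} (t'ₓ + t'ₙ₋ₓ).  Reflecting x ↦ n − x, that sum is a sum of t'
-- over an initial segment, which is computed from t'₂ₖ + t'₂ₖ₊₁ = 1: it is m + 1 for
-- n odd, and for n = 2m it is m + t'ₙ + t'ₘ = m + 1 since t'₂ₘ = 1 − t'ₘ when m ≥ 1.

open import Defs
open import Data.List using (List; _++_; applyUpTo; upTo; map; filter; length; cartesianProduct)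
open import Data.List.Properties using (length-++; filter-++; map-upTo)
open import Data.Nat using (ℕ; zero; suc; _+_; _*_; _∸_; _≤_; _<_; _≥_; _≟_; _≤?_; _/_; _%_; z≤n; s≤s; z<s; s<s)
open import Data.Nat.DivMod using (m/n<m; m*n%n≡0; m*n/n≡m; [m+kn]%n≡m%n; +-distrib-/-∣ʳ)
open import Data.Nat.Divisibility using (divides-refl)
open import Data.Nat.Properties
open import Algebra.Properties.CommutativeSemigroup +-commutativeSemigroup using (interchange; xy∙z≈xz∙y)
open import Data.Product using (_×_; _,_; ∃-syntax)
open import Data.Sum using (_⊎_; inj₁; inj₂)
open import Function using (_∘_)
open import Level using (0ℓ)
open import Relation.Binary.PropositionalEquality using (_≡_; _≢_; refl; sym; trans; cong; cong₂; module ≡-Reasoning)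
open import Relation.Nullary using (Dec; yes; no; ¬_; contradiction)
open import Relation.Nullary.Decidable using (_×-dec_)
open import Relation.Unary using (Pred; Decidable)

open ≡-Reasoning

∑ : (ℕ → ℕ) → ℕ → ℕ
∑ f zero    = 0
∑ f (suc n) = f 0 + ∑ (f ∘ suc) n

syntax ∑ (λ i → e) n = ∑[ i < n ] e

∑-cong : ∀ {f g} n → (∀ i → i < n → f i ≡ g i) → ∑ f n ≡ ∑ g n
∑-cong zero    f≗g = refl
∑-cong (suc n) f≗g = cong₂ _+_ (f≗g 0 z<s) (∑-cong n (λ i i<n → f≗g (suc i) (s<s i<n)))

∑-zero : ∀ {f} n → (∀ i → i < n → f i ≡ 0) → ∑ f n ≡ 0
∑-zero zero    f≗0 = refl
∑-zero (suc n) f≗0 = cong₂ _+_ (f≗0 0 z<s) (∑-zero n (λ i i<n → f≗0 (suc i) (s<s i<n)))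

∑-const : ∀ c n → ∑[ i < n ] c ≡ n * c
∑-const c zero    = refl
∑-const c (suc n) = cong (c +_) (∑-const c n)

∑-+ : ∀ f m n → ∑ f (m + n) ≡ ∑ f m + ∑[ i < n ] f (m + i)
∑-+ f zero    n = refl
∑-+ f (suc m) n = trans (cong (f 0 +_) (∑-+ (f ∘ suc) m n)) (sym (+-assoc (f 0) _ _))

∑-suc : ∀ f n → ∑ f (suc n) ≡ ∑ f n + f n
∑-suc f zero    = +-comm (f 0) 0
∑-suc f (suc n) = trans (cong (f 0 +_) (∑-suc (f ∘ suc) n)) (sym (+-assoc (f 0) _ _))

∑-distrib-+ : ∀ f g n → ∑[ i < n ] (f i + g i) ≡ ∑ f n + ∑ g n
∑-distrib-+ f g zero    = refl
∑-distrib-+ f g (suc n) =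
  trans (cong (f 0 + g 0 +_) (∑-distrib-+ (f ∘ suc) (g ∘ suc) n)) (interchange (f 0) (g 0) _ _)

∑-point : ∀ {f} n k → k < n → (∀ i → i ≢ k → f i ≡ 0) → ∑ f n ≡ f k
∑-point {f} (suc n) zero    _         f≗0 =
  trans (cong (f 0 +_) (∑-zero n (λ i _ → f≗0 (suc i) (λ ())))) (+-identityʳ (f 0))
∑-point {f} (suc n) (suc k) (s≤s k<n) f≗0 =
  trans (cong (_+ ∑ (f ∘ suc) n) (f≗0 0 (λ ())))
        (∑-point n k k<n (λ i i≢k → f≗0 (suc i) (i≢k ∘ suc-injective)))

∑-truncate : ∀ {f} m n → m ≤ n → (∀ i → m ≤ i → i < n → f i ≡ 0) → ∑ f n ≡ ∑ f m
∑-truncate {f} m n m≤n f≗0 = begin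
  ∑ f n                                 ≡⟨ cong (∑ f) (sym (m+[n∸m]≡n m≤n)) ⟩
  ∑ f (m + (n ∸ m))                     ≡⟨ ∑-+ f m (n ∸ m) ⟩
  ∑ f m + ∑[ i < n ∸ m ] f (m + i)      ≡⟨ cong (∑ f m +_) (∑-zero (n ∸ m) tail≗0) ⟩
  ∑ f m + 0                             ≡⟨ +-identityʳ (∑ f m) ⟩
  ∑ f m                                 ∎
  where
  tail≗0 : ∀ i → i < n ∸ m → f (m + i) ≡ 0
  tail≗0 i i<n∸m =
    f≗0 (m + i) (m≤m+n m i) (<-≤-trans (+-monoʳ-< m i<n∸m) (≤-reflexive (m+[n∸m]≡n m≤n)))

∑-reverse : ∀ f n → ∑[ i < suc n ] f (n ∸ i) ≡ ∑ f (suc n)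
∑-reverse f zero    = refl
∑-reverse f (suc n) = begin
  f (suc n) + ∑[ i < suc n ] f (n ∸ i)  ≡⟨ cong (f (suc n) +_) (∑-reverse f n) ⟩
  f (suc n) + ∑ f (suc n)               ≡⟨ +-comm (f (suc n)) _ ⟩
  ∑ f (suc n) + f (suc n)               ≡⟨ ∑-suc f (suc n) ⟨
  ∑ f (suc (suc n))                     ∎

∑-mirror : ∀ f m k → ∑[ x < suc m ] f (m + k ∸ x) ≡ ∑[ x < suc m ] f (k + x)
∑-mirror f m k = begin
  ∑[ x < suc m ] f (m + k ∸ x)   ≡⟨ ∑-cong (suc m) (λ x x<1+m → cong f (shift x (≤-pred x<1+m))) ⟩
  ∑[ x < suc m ] f (k + (m ∸ x)) ≡⟨ ∑-reverse (f ∘ (k +_)) m ⟩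
  ∑[ x < suc m ] f (k + x)       ∎
  where
  shift : ∀ x → x ≤ m → m + k ∸ x ≡ k + (m ∸ x)
  shift x x≤m = trans (+-∸-comm k x≤m) (+-comm (m ∸ x) k)

𝟙 : ∀ {a} {A : Set a} → Dec A → ℕ
𝟙 (yes _) = 1
𝟙 (no _)  = 0

𝟙-cong : ∀ {a b} {A : Set a} {B : Set b} → (A → B) → (B → A) → (a? : Dec A) (b? : Dec B) → 𝟙 a? ≡ 𝟙 b?
𝟙-cong A→B B→A (yes _) (yes _) = refl
𝟙-cong A→B B→A (yes a) (no ¬b) = contradiction (A→B a) ¬b
𝟙-cong A→B B→A (no ¬a) (yes b) = contradiction (B→A b) ¬a
𝟙-cong A→B B→A (no _)  (no _)  = refl

𝟙-no : ∀ {a} {A : Set a} → ¬ A → (a? : Dec A) → 𝟙 a? ≡ 0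
𝟙-no ¬a (yes a) = contradiction a ¬a
𝟙-no ¬a (no _)  = refl

module _ {a p} {A : Set a} {P : Pred A p} (P? : Decidable P) where

  length-filter-applyUpTo : ∀ (g : ℕ → A) n → length (filter P? (applyUpTo g n)) ≡ ∑[ i < n ] 𝟙 (P? (g i))
  length-filter-applyUpTo g zero = refl
  length-filter-applyUpTo g (suc n) with P? (g 0)
  ... | yes _ = cong suc (length-filter-applyUpTo (g ∘ suc) n)
  ... | no _  = length-filter-applyUpTo (g ∘ suc) n

module _ {a b p} {A : Set a} {B : Set b} {P : Pred (A × B) p} (P? : Decidable P) where

  length-filter-cartesianProduct : ∀ (g : ℕ → A) n (ys : List B) →
    length (filter P? (cartesianProduct (applyUpTo g n) ys)) ≡ ∑[ i < n ] length (filter P? (map (g i ,_) ys))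
  length-filter-cartesianProduct g zero    ys = refl
  length-filter-cartesianProduct g (suc n) ys = begin
    length (filter P? (map (g 0 ,_) ys ++ rest))                  ≡⟨ cong length (filter-++ P? (map (g 0 ,_) ys) rest) ⟩
    length (filter P? (map (g 0 ,_) ys) ++ filter P? rest)        ≡⟨ length-++ (filter P? (map (g 0 ,_) ys)) ⟩
    length (filter P? (map (g 0 ,_) ys)) + length (filter P? rest) ≡⟨ cong (_ +_) (length-filter-cartesianProduct (g ∘ suc) n ys) ⟩
    ∑[ i < suc n ] length (filter P? (map (g i ,_) ys))            ∎
    where rest = cartesianProduct (applyUpTo (g ∘ suc) n) ys

length-filter-upTo² : ∀ {p} {P : Pred (ℕ × ℕ) p} (P? : Decidable P) k l →
  length (filter P? (cartesianProduct (upTo k) (upTo l))) ≡ ∑[ x < k ] ∑[ y < l ] 𝟙 (P? (x , y))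
length-filter-upTo² P? k l =
  trans (length-filter-cartesianProduct P? (λ x → x) k (upTo l))
        (∑-cong k (λ x _ → trans (cong (length ∘ filter P?) (map-upTo (x ,_) l))
                                 (length-filter-applyUpTo P? (x ,_) l)))

IsPair : ℕ → ℕ → Pred (ℕ × ℕ) 0ℓ
IsPair b n (x , y) = t' x ≡ b × t' y ≡ b × x + y ≡ n × x ≤ y

-- `pairs b n` is definitionally `filter (isPair? b n)` applied to `upTo (suc n)` squared.
isPair? : ∀ b n → Decidable (IsPair b n)
isPair? b n (x , y) = t' x ≟ b ×-dec (t' y ≟ b ×-dec (x + y ≟ n ×-dec x ≤? y))

pairCount-diagonal : ∀ b n → pairCount b n ≡ ∑[ x < suc n ] 𝟙 (isPair? b n (x , n ∸ x))
pairCount-diagonal b n =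
  trans (length-filter-upTo² (isPair? b n) (suc n) (suc n))
        (∑-cong (suc n) (λ x _ → ∑-point (suc n) (n ∸ x) (s≤s (m∸n≤m n x)) (offDiagonal x)))
  where
  offDiagonal : ∀ x y → y ≢ n ∸ x → 𝟙 (isPair? b n (x , y)) ≡ 0
  offDiagonal x y y≢n∸x = 𝟙-no (λ (_ , _ , x+y≡n , _) → y≢n∸x (trans (sym (m+n∸m≡n x y)) (cong (_∸ x) x+y≡n))) _

pairCount-half : ∀ b {n m} → m + m ≤ n → n ≤ m + suc m →
  pairCount b n ≡ ∑[ x < suc m ] 𝟙 (t' x ≟ b ×-dec t' (n ∸ x) ≟ b)
pairCount-half b {n} {m} 2m≤n n≤2m+1 = begin
  pairCount b n                                          ≡⟨ pairCount-diagonal b n ⟩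
  ∑[ x < suc n ] 𝟙 (isPair? b n (x , n ∸ x))            ≡⟨ ∑-truncate (suc m) (suc n) (s≤s m≤n) upper ⟩
  ∑[ x < suc m ] 𝟙 (isPair? b n (x , n ∸ x))            ≡⟨ ∑-cong (suc m) lower ⟩
  ∑[ x < suc m ] 𝟙 (t' x ≟ b ×-dec t' (n ∸ x) ≟ b)      ∎
  where
  m≤n : m ≤ n
  m≤n = ≤-trans (m≤m+n m m) 2m≤n

  upper : ∀ x → suc m ≤ x → x < suc n → 𝟙 (isPair? b n (x , n ∸ x)) ≡ 0
  upper x m<x _ = 𝟙-no (λ (_ , _ , _ , x≤n∸x) → <-irrefl refl
    (<-≤-trans (+-mono-≤ m<x m<x) (≤-trans (m≤o∸n⇒m+n≤o x (≤-trans x≤n∸x (m∸n≤m n x)) x≤n∸x) n≤2m+1))) _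

  lower : ∀ x → x < suc m → 𝟙 (isPair? b n (x , n ∸ x)) ≡ 𝟙 (t' x ≟ b ×-dec t' (n ∸ x) ≟ b)
  lower x (s≤s x≤m) = 𝟙-cong (λ (p , q , _) → p , q) (λ (p , q) → p , q , m+[n∸m]≡n x≤n , x≤n∸x) _ _
    where
    x+x≤n : x + x ≤ n
    x+x≤n = ≤-trans (+-mono-≤ x≤m x≤m) 2m≤n
    x≤n : x ≤ n
    x≤n = ≤-trans (m≤m+n x x) x+x≤n
    x≤n∸x : x ≤ n ∸ x
    x≤n∸x = m+n≤o⇒m≤o∸n x x+x≤n

tp-aux≤1 : ∀ f n → tp-aux f n ≤ 1
tp-aux≤1 f       0             = s≤s z≤n
tp-aux≤1 f       1             = z≤n
tp-aux≤1 zero    (suc (suc n)) = z≤n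
tp-aux≤1 (suc f) (suc (suc n)) with suc (suc n) % 2
... | zero  = m∸n≤m 1 (tp-aux f (suc (suc n) / 2))
... | suc _ = tp-aux≤1 f (suc (suc n) / 2)

t'≤1 : ∀ n → t' n ≤ 1
t'≤1 n = tp-aux≤1 n n

half≤fuel : ∀ n f → suc (suc n) ≤ suc f → suc (suc n) / 2 ≤ f
half≤fuel n f 2+n≤1+f = ≤-pred (<-≤-trans (m/n<m (suc (suc n)) 2 (s≤s (s≤s z≤n))) 2+n≤1+f)

tp-aux-fuel : ∀ f g n → n ≤ f → n ≤ g → tp-aux f n ≡ tp-aux g n
tp-aux-fuel f       g       0             _ _ = refl
tp-aux-fuel f       g       1             _ _ = refl
tp-aux-fuel (suc f) (suc g) (suc (suc n)) n≤f n≤g with suc (suc n) % 2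
... | zero  = cong (1 ∸_) (tp-aux-fuel f g _ (half≤fuel n f n≤f) (half≤fuel n g n≤g))
... | suc _ = tp-aux-fuel f g _ (half≤fuel n f n≤f) (half≤fuel n g n≤g)

t'-even-step : ∀ j → suc (suc j) % 2 ≡ 0 → t' (suc (suc j)) ≡ 1 ∸ t' (suc (suc j) / 2)
t'-even-step j even with suc (suc j) % 2 | even
... | zero  | _  = cong (1 ∸_) (tp-aux-fuel (suc j) _ _ (half≤fuel j (suc j) ≤-refl) ≤-refl)
... | suc _ | ()

t'-odd-step : ∀ j → suc (suc j) % 2 ≡ 1 → t' (suc (suc j)) ≡ t' (suc (suc j) / 2)
t'-odd-step j odd with suc (suc j) % 2 | odd
... | zero  | ()
... | suc _ | _  = tp-aux-fuel (suc j) _ _ (half≤fuel j (suc j) ≤-refl) ≤-refl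

n+n≡n*2 : ∀ n → n + n ≡ n * 2
n+n≡n*2 n = trans (cong (n +_) (sym (+-identityʳ n))) (*-comm 2 n)

t'-double : ∀ k → t' (suc k + suc k) ≡ 1 ∸ t' (suc k)
t'-double k = begin
  t' (suc k + suc k)          ≡⟨ cong t' (n+n≡n*2 (suc k)) ⟩
  t' (suc k * 2)              ≡⟨ t'-even-step (k * 2) (m*n%n≡0 (suc k) 2) ⟩
  1 ∸ t' (suc k * 2 / 2)      ≡⟨ cong (λ i → 1 ∸ t' i) (m*n/n≡m (suc k) 2) ⟩
  1 ∸ t' (suc k)              ∎

t'-double+1 : ∀ k → t' (suc (suc k + suc k)) ≡ t' (suc k)
t'-double+1 k = begin
  t' (suc (suc k + suc k))    ≡⟨ cong (t' ∘ suc) (n+n≡n*2 (suc k)) ⟩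
  t' (1 + suc k * 2)          ≡⟨ t'-odd-step (suc (k * 2)) ([m+kn]%n≡m%n 1 (suc k) 2) ⟩
  t' ((1 + suc k * 2) / 2)    ≡⟨ cong t' (+-distrib-/-∣ʳ 1 {d = 2} (divides-refl (suc k))) ⟩
  t' (suc k * 2 / 2)          ≡⟨ cong t' (m*n/n≡m (suc k) 2) ⟩
  t' (suc k)                  ∎

t'-pair : ∀ k → t' (k + k) + t' (suc (k + k)) ≡ 1
t'-pair zero    = refl
t'-pair (suc k) = trans (cong₂ _+_ (t'-double k) (t'-double+1 k)) (m∸n+n≡m (t'≤1 (suc k)))

∑-t'-double : ∀ k → ∑ t' (k + k) ≡ k
∑-t'-double zero    = refl
∑-t'-double (suc k) = begin
  ∑ t' (suc k + suc k)                             ≡⟨ cong (∑ t' ∘ suc) (+-suc k k) ⟩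
  ∑ t' (suc (suc (k + k)))                         ≡⟨ ∑-suc t' (suc (k + k)) ⟩
  ∑ t' (suc (k + k)) + t' (suc (k + k))            ≡⟨ cong (_+ t' (suc (k + k))) (∑-suc t' (k + k)) ⟩
  ∑ t' (k + k) + t' (k + k) + t' (suc (k + k))     ≡⟨ +-assoc (∑ t' (k + k)) _ _ ⟩
  ∑ t' (k + k) + (t' (k + k) + t' (suc (k + k)))   ≡⟨ cong₂ _+_ (∑-t'-double k) (t'-pair k) ⟩
  k + 1                                            ≡⟨ +-comm k 1 ⟩
  suc k                                            ∎

∑-t'-mirror-odd : ∀ m → ∑[ x < suc m ] (t' x + t' (m + suc m ∸ x)) ≡ suc m
∑-t'-mirror-odd m = begin
  ∑[ x < suc m ] (t' x + t' (m + suc m ∸ x))           ≡⟨ ∑-distrib-+ t' (λ x → t' (m + suc m ∸ x)) (suc m) ⟩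
  ∑ t' (suc m) + ∑[ x < suc m ] t' (m + suc m ∸ x)     ≡⟨ cong (∑ t' (suc m) +_) (∑-mirror t' m (suc m)) ⟩
  ∑ t' (suc m) + ∑[ x < suc m ] t' (suc m + x)         ≡⟨ ∑-+ t' (suc m) (suc m) ⟨
  ∑ t' (suc m + suc m)                                 ≡⟨ ∑-t'-double (suc m) ⟩
  suc m                                                ∎

∑-t'-mirror-even : ∀ {m} → m ≥ 1 → ∑[ x < suc m ] (t' x + t' (m + m ∸ x)) ≡ suc m
∑-t'-mirror-even {m@(suc k)} _ = begin
  ∑[ x < suc m ] (t' x + t' (m + m ∸ x))           ≡⟨ ∑-distrib-+ t' (λ x → t' (m + m ∸ x)) (suc m) ⟩
  ∑ t' (suc m) + ∑[ x < suc m ] t' (m + m ∸ x)     ≡⟨ cong (∑ t' (suc m) +_) (∑-mirror t' m m) ⟩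
  ∑ t' (suc m) + ∑[ x < suc m ] t' (m + x)         ≡⟨ cong (_+ ∑[ x < suc m ] t' (m + x)) (∑-suc t' m) ⟩
  ∑ t' m + t' m + ∑[ x < suc m ] t' (m + x)        ≡⟨ xy∙z≈xz∙y (∑ t' m) (t' m) (∑[ x < suc m ] t' (m + x)) ⟩
  ∑ t' m + ∑[ x < suc m ] t' (m + x) + t' m        ≡⟨ cong (_+ t' m) (∑-+ t' m (suc m)) ⟨
  ∑ t' (m + suc m) + t' m                          ≡⟨ cong (λ i → ∑ t' i + t' m) (+-suc m m) ⟩
  ∑ t' (suc (m + m)) + t' m                        ≡⟨ cong (_+ t' m) (∑-suc t' (m + m)) ⟩
  ∑ t' (m + m) + t' (m + m) + t' m                 ≡⟨ +-assoc (∑ t' (m + m)) _ _ ⟩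
  ∑ t' (m + m) + (t' (m + m) + t' m)               ≡⟨ cong₂ _+_ (∑-t'-double m) t'[2m]+t'[m]≡1 ⟩
  m + 1                                            ≡⟨ +-comm m 1 ⟩
  suc m                                            ∎
  where
  t'[2m]+t'[m]≡1 : t' (m + m) + t' m ≡ 1
  t'[2m]+t'[m]≡1 = trans (cong (_+ t' m) (t'-double k)) (m∸n+n≡m (t'≤1 m))

both-identity : ∀ {u v} → u ≤ 1 → v ≤ 1 →
  𝟙 (u ≟ 0 ×-dec v ≟ 0) + (u + v) ≡ 𝟙 (u ≟ 1 ×-dec v ≟ 1) + 1
both-identity z≤n       z≤n       = refl
both-identity z≤n       (s≤s z≤n) = refl
both-identity (s≤s z≤n) z≤n       = refl
both-identity (s≤s z≤n) (s≤s z≤n) = refl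

pairCount-balance : ∀ {n m} → m + m ≤ n → n ≤ m + suc m →
  pairCount 0 n + ∑[ x < suc m ] (t' x + t' (n ∸ x)) ≡ pairCount 1 n + suc m
pairCount-balance {n} {m} 2m≤n n≤2m+1 = begin
  pairCount 0 n + ∑[ x < suc m ] (t' x + t' (n ∸ x))
    ≡⟨ cong (_+ ∑[ x < suc m ] (t' x + t' (n ∸ x))) (pairCount-half 0 2m≤n n≤2m+1) ⟩
  ∑[ x < suc m ] both 0 x + ∑[ x < suc m ] (t' x + t' (n ∸ x))
    ≡⟨ ∑-distrib-+ (both 0) (λ x → t' x + t' (n ∸ x)) (suc m) ⟨
  ∑[ x < suc m ] (both 0 x + (t' x + t' (n ∸ x)))
    ≡⟨ ∑-cong (suc m) (λ x _ → both-identity (t'≤1 x) (t'≤1 (n ∸ x))) ⟩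
  ∑[ x < suc m ] (both 1 x + 1)
    ≡⟨ ∑-distrib-+ (both 1) (λ _ → 1) (suc m) ⟩
  ∑[ x < suc m ] both 1 x + ∑[ x < suc m ] 1
    ≡⟨ cong₂ _+_ (sym (pairCount-half 1 2m≤n n≤2m+1)) (trans (∑-const 1 (suc m)) (*-identityʳ (suc m))) ⟩
  pairCount 1 n + suc m
    ∎
  where
  both : ℕ → ℕ → ℕ
  both b x = 𝟙 (t' x ≟ b ×-dec t' (n ∸ x) ≟ b)

pairCount-equal : ∀ {n m} → m + m ≤ n → n ≤ m + suc m →
  ∑[ x < suc m ] (t' x + t' (n ∸ x)) ≡ suc m → pairCount 0 n ≡ pairCount 1 n
pairCount-equal {n} {m} 2m≤n n≤2m+1 ∑≡1+m =
  +-cancelʳ-≡ (suc m) _ _ (trans (cong (pairCount 0 n +_) (sym ∑≡1+m)) (pairCount-balance 2m≤n n≤2m+1))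

even⊎odd : ∀ n → ∃[ m ] (n ≡ m + m ⊎ n ≡ m + suc m)
even⊎odd zero = 0 , inj₁ refl
even⊎odd (suc n) with even⊎odd n
... | m , inj₁ n≡2m   = m , inj₂ (trans (cong suc n≡2m) (sym (+-suc m m)))
... | m , inj₂ n≡2m+1 = suc m , inj₁ (cong suc n≡2m+1)

theorem6 : (n : ℕ) → n ≥ 1 → pairCount 0 n ≡ pairCount 1 n
theorem6 n n≥1 with even⊎odd n
theorem6 _ ()  | zero , inj₁ refl
theorem6 _ _   | m@(suc _) , inj₁ refl =
  pairCount-equal ≤-refl (+-monoʳ-≤ m (n≤1+n m)) (∑-t'-mirror-even (s≤s z≤n))
theorem6 _ _   | m , inj₂ refl =
  pairCount-equal (+-monoʳ-≤ m (n≤1+n m)) ≤-refl (∑-t'-mirror-odd m)
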